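{- For $n>0$, the set of relations $$\mathrm{PC}_2(n)=\{\alpha'_{x,zy}:c_xc_{zy}\Rightarrow c_{zx}c_y\mid 1\le x\le y<z\le n\}\cup\{\alpha'_{y,zx}:c_yc_{zx}\Rightarrow c_{yx}c_z\mid 1\le x<y\le z\le n\}$$ is equal to the set of $2$-cells $\alpha_{u,v}:c_uc_v\Rightarrow c_wc_{w'}$ of the column presentation $\mathrm{Col}_2(n)$ with $\ell(u)=1$, $\ell(v)=2$ and such that the Schensted tableau $P(uv)$ has two columns and $(u,v)$ does not form a tableau.
   Context: Let $[n]=\{1<\dots<n\}$. A column is a word $x_p\dots x_1$ over $[n]$ with $x_p>\dots>x_1$; $\mathrm{col}(n)$ is the set of nonempty columns and $\ell$ denotes word length. For columns $u=x_p\dots x_1$ and $v=y_q\dots y_1$, $(u,v)$ forms a tableau if $p\ge q$ and $x_i\le y_i$ for all $i\le q$. $P(w)$ denotes the Schensted tableau of a word $w$ (by Schensted row insertion); for columns $u,v$ it has at most two columns, each read from bottom to top in the planar representation as an element of $\mathrm{col}(n)$. The column presentation $\mathrm{Col}_2(n)$ has generators $c_u$, $u\in\mathrm{col}(n)$, and a $2$-cell $\alpha_{u,v}:c_uc_v\Rightarrow c_wc_{w'}$ for each pair of columns $(u,v)$ not forming a tableau, where $w,w'$ are the left and right columns of $P(uv)$. -}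

module Defs where

open import Data.Nat using (ℕ; zero; suc; _≤_; _<_; _>_; _≤ᵇ_)
open import Data.Bool using (Bool; true; false; if_then_else_)
open import Data.List using (List; []; _∷_; _++_; reverse; length; map; foldl; upTo)
open import Data.List.Relation.Unary.All using (All)
open import Data.List.Relation.Unary.Linked using (Linked)
open import Data.Maybe using (Maybe; just; nothing)
open import Data.Product using (_×_)
open import Data.Unit using (⊤)
open import Data.Empty using (⊥)
open import Relation.Nullary using (¬_)
open import Relation.Binary.PropositionalEquality using (_≡_)

-- Letters of [n] are natural numbers x with 1 ≤ x ≤ n.
-- A word is a List ℕ, written left to right.

IsCol : ℕ → List ℕ → Set
IsCol n u = ¬ (u ≡ []) × Linked _>_ u × All (λ x → 1 ≤ x × x ≤ n) u

tabAux : List ℕ → List ℕ → Set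
tabAux _ [] = ⊤
tabAux [] (_ ∷ _) = ⊥
tabAux (x ∷ xs) (y ∷ ys) = x ≤ y × tabAux xs ys

-- (u , v) forms a tableau; columns are words x_p … x_1, so we reverse to index from x_1
FormsTableau : List ℕ → List ℕ → Set
FormsTableau u v = tabAux (reverse u) (reverse v)

-- A tableau is a list of rows (top row first),
-- each row a weakly increasing list read left to right.
rowInsert : ℕ → List ℕ → Maybe ℕ × List ℕ
rowInsert a [] = nothing Data.Product., (a ∷ [])
rowInsert a (b ∷ r) with b ≤ᵇ a
... | true  = let res = rowInsert a r in Data.Product.proj₁ res Data.Product., (b ∷ Data.Product.proj₂ res)
... | false = just b Data.Product., (a ∷ r)

insert : ℕ → List (List ℕ) → List (List ℕ)
insert a [] = (a ∷ []) ∷ []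
insert a (r ∷ rs) with rowInsert a r
... | nothing Data.Product., r' = r' ∷ rs
... | just b  Data.Product., r' = r' ∷ insert b rs

P : List ℕ → List (List ℕ)
P w = foldl (λ T a → insert a T) [] w

lookupMaybe : List ℕ → ℕ → Maybe ℕ
lookupMaybe [] _ = nothing
lookupMaybe (x ∷ xs) zero = just x
lookupMaybe (x ∷ xs) (suc j) = lookupMaybe xs j

entriesAt : ℕ → List (List ℕ) → List ℕ
entriesAt j [] = []
entriesAt j (r ∷ rs) with lookupMaybe r j
... | nothing = entriesAt j rs
... | just x  = x ∷ entriesAt j rs

-- The j-th column (from the left) of a tableau, read from bottom to top
-- (so it is a word x_p … x_1 with x_p > … > x_1).
column : ℕ → List (List ℕ) → List ℕ
column j T = reverse (entriesAt j T)

firstRowLength : List (List ℕ) → ℕ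
firstRowLength [] = 0
firstRowLength (r ∷ _) = length r

columns : List (List ℕ) → List (List ℕ)
columns T = map (λ j → column j T) (upTo (firstRowLength T))

ColCellTwoCols : ℕ → List ℕ → List ℕ → List ℕ → List ℕ → Set
ColCellTwoCols n u v w w' =
  IsCol n u × IsCol n v × ¬ FormsTableau u v × columns (P (u ++ v)) ≡ w ∷ w' ∷ []

-- PC_2(n): relations c_u c_v ⇒ c_w c_{w'} given as quadruples (u , v , w , w')
data PC2 (n : ℕ) : List ℕ → List ℕ → List ℕ → List ℕ → Set where
  α'₁ : ∀ {x y z} → 1 ≤ x → x ≤ y → y < z → z ≤ n →
        PC2 n (x ∷ []) (z ∷ y ∷ []) (z ∷ x ∷ []) (y ∷ [])
  α'₂ : ∀ {x y z} → 1 ≤ x → x < y → y ≤ z → z ≤ n →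
        PC2 n (y ∷ []) (z ∷ x ∷ []) (y ∷ x ∷ []) (z ∷ [])

-- A letter a and a two-letter column cb (b < c) never form a tableau, and
-- P(acb) is computed by hand in three regimes: for a ≤ b the letter c is bumped
-- under a, for b < a ≤ c the letter a is bumped under b, and for c < a the
-- tableau is the single column acb. Exactly the first two regimes give two
-- columns, and they are the two families of PC₂(n).
module Submission where

open import Defs
open import Data.Nat using (ℕ; _<_; _≤_; _≤ᵇ_; z≤n; s≤s)
open import Data.Nat.Properties using (_≤?_; <⇒≱; ≤-trans; <⇒≤; ≰⇒>; <-≤-trans; ≤-refl)
open import Data.Bool using (true; false)
open import Data.List using (List; length; reverse; []; _∷_)
open import Data.List.Properties using (length-reverse)
open import Data.List.Relation.Unary.All using ([]; _∷_)
open import Data.List.Relation.Unary.Linked using ([-]; _∷_)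
open import Data.Product using (_×_; _,_)
open import Function.Bundles using (_⇔_; mk⇔)
open import Relation.Nullary using (¬_; yes; no)
open import Relation.Nullary.Decidable using (dec-true; dec-false)
open import Relation.Binary.PropositionalEquality using (_≡_; refl; sym; trans; subst₂)

-- does (m ≤? n) is definitionally m ≤ᵇ n, the test that row insertion branches on.
≤ᵇ-true : ∀ {m n} → m ≤ n → (m ≤ᵇ n) ≡ true
≤ᵇ-true {m} {n} = dec-true (m ≤? n)

≤ᵇ-false : ∀ {m n} → n < m → (m ≤ᵇ n) ≡ false
≤ᵇ-false {m} {n} n<m = dec-false (m ≤? n) (<⇒≱ n<m)

tabAux⇒length≤ : ∀ xs ys → tabAux xs ys → length ys ≤ length xs
tabAux⇒length≤ _        []       _       = z≤n
tabAux⇒length≤ (_ ∷ xs) (_ ∷ ys) (_ , t) = s≤s (tabAux⇒length≤ xs ys t)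

FormsTableau⇒length≤ : ∀ u v → FormsTableau u v → length v ≤ length u
FormsTableau⇒length≤ u v t =
  subst₂ _≤_ (length-reverse v) (length-reverse u) (tabAux⇒length≤ (reverse u) (reverse v) t)

shorter⇒¬FormsTableau : ∀ u v → length u < length v → ¬ FormsTableau u v
shorter⇒¬FormsTableau u v u<v t = <⇒≱ u<v (FormsTableau⇒length≤ u v t)

isCol-letter : ∀ {n a} → 1 ≤ a → a ≤ n → IsCol n (a ∷ [])
isCol-letter 1≤a a≤n = (λ ()) , [-] , (1≤a , a≤n) ∷ []

isCol-pair : ∀ {n b c} → 1 ≤ b → b < c → c ≤ n → IsCol n (c ∷ b ∷ [])
isCol-pair 1≤b b<c c≤n =
  (λ ()) , b<c ∷ [-] , (≤-trans 1≤b (<⇒≤ b<c) , c≤n) ∷ (1≤b , ≤-trans (<⇒≤ b<c) c≤n) ∷ []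

columns-P-a≤b : ∀ {a b c} → a ≤ b → b < c →
  columns (P (a ∷ c ∷ b ∷ [])) ≡ (c ∷ a ∷ []) ∷ (b ∷ []) ∷ []
columns-P-a≤b a≤b b<c
  rewrite ≤ᵇ-true (≤-trans a≤b (<⇒≤ b<c)) | ≤ᵇ-true a≤b | ≤ᵇ-false b<c = refl

columns-P-b<a≤c : ∀ {a b c} → b < a → a ≤ c →
  columns (P (a ∷ c ∷ b ∷ [])) ≡ (a ∷ b ∷ []) ∷ (c ∷ []) ∷ []
columns-P-b<a≤c b<a a≤c rewrite ≤ᵇ-true a≤c | ≤ᵇ-false b<a = refl

columns-P-b<c<a : ∀ {a b c} → b < c → c < a →
  columns (P (a ∷ c ∷ b ∷ [])) ≡ (a ∷ c ∷ b ∷ []) ∷ []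
columns-P-b<c<a b<c c<a rewrite ≤ᵇ-false c<a | ≤ᵇ-false b<c | ≤ᵇ-false c<a = refl

PC2⇒ColCell : ∀ {n u v w w'} → PC2 n u v w w' →
  ColCellTwoCols n u v w w' × length u ≡ 1 × length v ≡ 2
PC2⇒ColCell (α'₁ {x} {y} {z} 1≤x x≤y y<z z≤n') =
  ( isCol-letter 1≤x (≤-trans x≤y (≤-trans (<⇒≤ y<z) z≤n'))
  , isCol-pair (≤-trans 1≤x x≤y) y<z z≤n'
  , shorter⇒¬FormsTableau (x ∷ []) (z ∷ y ∷ []) ≤-refl
  , columns-P-a≤b x≤y y<z ) , refl , refl
PC2⇒ColCell (α'₂ {x} {y} {z} 1≤x x<y y≤z z≤n') =
  ( isCol-letter (≤-trans 1≤x (<⇒≤ x<y)) (≤-trans y≤z z≤n')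
  , isCol-pair 1≤x (<-≤-trans x<y y≤z) z≤n'
  , shorter⇒¬FormsTableau (y ∷ []) (z ∷ x ∷ []) ≤-refl
  , columns-P-b<a≤c x<y y≤z ) , refl , refl

ColCell⇒PC2 : ∀ {n u v w w'} →
  ColCellTwoCols n u v w w' × length u ≡ 1 × length v ≡ 2 → PC2 n u v w w'
ColCell⇒PC2 {u = a ∷ []} {v = c ∷ b ∷ []}
  (((_ , _ , (1≤a , _) ∷ []) , (_ , b<c ∷ _ , (_ , c≤n) ∷ (1≤b , _) ∷ []) , _ , cols) , _)
  with a ≤? b | a ≤? c
... | yes a≤b | _
  with refl ← trans (sym (columns-P-a≤b a≤b b<c)) cols = α'₁ 1≤a a≤b b<c c≤n
... | no a≰b | yes a≤c
  with refl ← trans (sym (columns-P-b<a≤c (≰⇒> a≰b) a≤c)) cols = α'₂ 1≤b (≰⇒> a≰b) a≤c c≤n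
... | no _ | no a≰c
  with () ← trans (sym (columns-P-b<c<a b<c (≰⇒> a≰c))) cols

lemma4p3p3 : (n : ℕ) → 0 < n → (u v w w' : List ℕ) →
    PC2 n u v w w' ⇔ (ColCellTwoCols n u v w w' × length u ≡ 1 × length v ≡ 2)
lemma4p3p3 n _ u v w w' = mk⇔ PC2⇒ColCell ColCell⇒PC2
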